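{- Let $(T;<)$ be a tree, let $\mathcal{S}$ be the set of all stems of $T$ that have no supremum in $T$, and for each $\mathsf{S}\in\mathcal{S}$ let $t_{\mathsf{S}}$ be a new element not in $T$ (distinct for distinct $\mathsf{S}$). Let $T^{DC}:=T\cup\{t_{\mathsf{S}}:\mathsf{S}\in\mathcal{S}\}$ and let $<^{DC}$ be the relation on $T^{DC}$ consisting of: all pairs $(x,y)\in T\times T$ with $x<y$; all pairs $(t_{\mathsf{R}},t_{\mathsf{S}})$ with $\mathsf{R},\mathsf{S}\in\mathcal{S}$, $\mathsf{R}\subsetneq\mathsf{S}$; all pairs $(u,t_{\mathsf{S}})$ with $\mathsf{S}\in\mathcal{S}$, $u\in\mathsf{S}$; and all pairs $(t_{\mathsf{S}},u)$ with $\mathsf{S}\in\mathcal{S}$ and $u\in T$ an upper bound of $\mathsf{S}$. Then $(T^{DC};<^{DC})$ is a complete tree containing $(T;<)$ as a substructure.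
   Context: A tree is a set $T$ with a strict partial order $<$ such that for every $x\in T$ the set $\{y:y<x\}$ is linearly ordered, and any two nodes have a common lower bound (no well-foundedness or root assumed). A stem is a non-empty downward-closed linearly ordered set of nodes that is bounded above. A tree is complete if every non-empty set of nodes that is bounded below has an infimum. -}

module Defs where

open import Level using (Level; _⊔_; suc; Lift)
open import Data.Empty using (⊥)
open import Data.Sum using (_⊎_; inj₁; inj₂)
open import Data.Product using (Σ; ∃; _×_; _,_)
open import Relation.Nullary using (¬_)
open import Relation.Unary using (Pred; _⊆_)
open import Relation.Binary.Core using (Rel)
open import Relation.Binary.Structures using (IsStrictPartialOrder)
open import Relation.Binary.PropositionalEquality using (_≡_)

module Order {a e r : Level} {A : Set a} (_≈_ : Rel A e) (_<_ : Rel A r) where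

  _≤_ : Rel A (e ⊔ r)
  x ≤ y = x < y ⊎ x ≈ y

  Linear : ∀ {p} → Pred A p → Set (a ⊔ p ⊔ e ⊔ r)
  Linear S = ∀ {x y} → S x → S y → x < y ⊎ x ≈ y ⊎ y < x

  IsUpperBound : ∀ {p} → Pred A p → A → Set (a ⊔ p ⊔ e ⊔ r)
  IsUpperBound S u = ∀ x → S x → x ≤ u

  IsLowerBound : ∀ {p} → Pred A p → A → Set (a ⊔ p ⊔ e ⊔ r)
  IsLowerBound S l = ∀ x → S x → l ≤ x

  IsSupremum : ∀ {p} → Pred A p → A → Set (a ⊔ p ⊔ e ⊔ r)
  IsSupremum S u = IsUpperBound S u × (∀ v → IsUpperBound S v → u ≤ v)

  IsInfimum : ∀ {p} → Pred A p → A → Set (a ⊔ p ⊔ e ⊔ r)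
  IsInfimum S l = IsLowerBound S l × (∀ m → IsLowerBound S m → m ≤ l)

  record IsTree : Set (a ⊔ e ⊔ r) where
    field
      isStrictPartialOrder : IsStrictPartialOrder _≈_ _<_
      predLinear : ∀ x → Linear (λ y → y < x)
      commonLowerBound : ∀ x y → ∃ λ z → z ≤ x × z ≤ y

  record IsStem {p} (S : Pred A p) : Set (a ⊔ p ⊔ e ⊔ r) where
    field
      nonEmpty : ∃ λ x → S x
      downClosed : ∀ {x y} → S y → x < y → S x
      linear : Linear S
      boundedAbove : ∃ λ u → IsUpperBound S u

  HasSupremum : ∀ {p} → Pred A p → Set (a ⊔ p ⊔ e ⊔ r)
  HasSupremum S = ∃ λ u → IsSupremum S u

  IsComplete : (p : Level) → Set (a ⊔ suc p ⊔ e ⊔ r)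
  IsComplete p = (S : Pred A p) → (∃ λ x → S x) → (∃ λ l → IsLowerBound S l)
               → ∃ λ m → IsInfimum S m

module DC {ℓ : Level} (T : Set ℓ) (_<_ : Rel T ℓ) where
  open Order {A = T} _≡_ _<_

  NewStem : Set (suc ℓ)
  NewStem = Σ (Pred T ℓ) (λ S → IsStem S × ¬ HasSupremum S)

  -- T^DC = T ∪ { t_S : S ∈ 𝒮 }; inj₂ (S , _) is the new node t_S
  TDC : Set (suc ℓ)
  TDC = T ⊎ NewStem

  -- equality on T^DC: t_S and t_R coincide exactly when S and R are the
  -- same set of nodes (extensional equality of predicates)
  _≈ᴰ_ : Rel TDC ℓ
  inj₁ x ≈ᴰ inj₁ y = x ≡ y
  inj₁ x ≈ᴰ inj₂ S = Lift ℓ ⊥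
  inj₂ R ≈ᴰ inj₁ y = Lift ℓ ⊥
  inj₂ (R , _) ≈ᴰ inj₂ (S , _) = R ⊆ S × S ⊆ R

  _<ᴰ_ : Rel TDC ℓ
  inj₁ x <ᴰ inj₁ y = x < y
  inj₂ (R , _) <ᴰ inj₂ (S , _) = R ⊆ S × ¬ (S ⊆ R)
  inj₁ u <ᴰ inj₂ (S , _) = S u
  inj₂ (S , _) <ᴰ inj₁ u = IsUpperBound S u

{-# OPTIONS --safe #-}
module Submission where

-- Classically, two down-sets of a tree whose elements are pairwise comparable
-- are ⊆-comparable, and a node comparable with every element of a down-set
-- lies in it or bounds it. Below any node z of T^DC, each new node t_R has R
-- inside the linear set of T-nodes below z, so these two facts make the
-- predecessors of z linear. For completeness, the T-nodes L below every
-- element of X form a stem; X has infimum sup L if L has a supremum, and t_L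
-- otherwise.

open import Defs
open import Level using (Level; suc; Lift; lift; lower)
open import Data.Product using (∃; _×_; _,_; proj₁; proj₂)
open import Data.Sum using (_⊎_; inj₁; inj₂; [_,_]′; fromInj₂)
open import Data.Empty using (⊥-elim)
open import Function using (id; _∘_)
open import Function.Bundles using (_⇔_; mk⇔)
open import Relation.Nullary using (¬_; yes; no)
open import Relation.Nullary.Decidable using (map′; True; toWitness; fromWitness)
open import Relation.Unary using (Pred; _⊆_)
open import Relation.Binary.Core using (Rel)
open import Relation.Binary.Structures using (IsStrictPartialOrder)
open import Relation.Binary.PropositionalEquality using (_≡_; refl; sym; trans)
open import Axiom.ExcludedMiddle using (ExcludedMiddle)

lowerExcludedMiddle : ∀ {ℓ} → ExcludedMiddle (suc ℓ) → ExcludedMiddle ℓ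
lowerExcludedMiddle em = map′ lower lift em

module DownSets {ℓ : Level} (dec : ExcludedMiddle ℓ) {A : Set ℓ} (_<_ : Rel A ℓ) where
  open Order _≡_ _<_

  DownClosed : Pred A ℓ → Set ℓ
  DownClosed R = ∀ {x y} → R y → x < y → R x

  Comparable : Rel A ℓ
  Comparable x y = x < y ⊎ x ≡ y ⊎ y < x

  downClosed-≤ : ∀ {R x y} → DownClosed R → R y → x ≤ y → R x
  downClosed-≤ dc Ry (inj₁ x<y) = dc Ry x<y
  downClosed-≤ dc Ry (inj₂ refl) = Ry

  ⊆⊎witness-∉ : ∀ {R S : Pred A ℓ} → R ⊆ S ⊎ ∃ λ r → R r × ¬ S r
  ⊆⊎witness-∉ {R} {S} with dec {∃ λ r → R r × ¬ S r}
  ... | yes witness = inj₂ witness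
  ... | no noWitness = inj₁ included
    where
      included : R ⊆ S
      included {r} Rr with dec {S r}
      ... | yes Sr = Sr
      ... | no ¬Sr = ⊥-elim (noWitness (r , Rr , ¬Sr))

  member⊎upperBound : ∀ {R y} → DownClosed R → (∀ r → R r → Comparable r y)
                    → R y ⊎ IsUpperBound R y
  member⊎upperBound {R} {y} dc cmp with dec {R y}
  ... | yes Ry = inj₁ Ry
  ... | no ¬Ry = inj₂ bound
    where
      bound : IsUpperBound R y
      bound r Rr with cmp r Rr
      ... | inj₁ r<y = inj₁ r<y
      ... | inj₂ (inj₁ refl) = ⊥-elim (¬Ry Rr)
      ... | inj₂ (inj₂ y<r) = ⊥-elim (¬Ry (dc Rr y<r))

  ⊆-total : ∀ {R S} → DownClosed R → DownClosed S
          → (∀ {r s} → R r → S s → Comparable r s) → R ⊆ S ⊎ S ⊆ R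
  ⊆-total {R} {S} dcR dcS cmp with ⊆⊎witness-∉ {R} {S}
  ... | inj₁ R⊆S = inj₁ R⊆S
  ... | inj₂ (r , Rr , ¬Sr) = inj₂ (λ Ss → downClosed-≤ dcR Rr (bounds _ Ss))
    where
      bounds : IsUpperBound S r
      bounds = fromInj₂ (⊥-elim ∘ ¬Sr)
        (member⊎upperBound dcS (λ s Ss → swap (cmp Rr Ss)))
        where
          swap : ∀ {x y} → Comparable x y → Comparable y x
          swap (inj₁ x<y) = inj₂ (inj₂ x<y)
          swap (inj₂ (inj₁ refl)) = inj₂ (inj₁ refl)
          swap (inj₂ (inj₂ y<x)) = inj₁ y<x

module Completion {ℓ : Level} (em : ExcludedMiddle (suc ℓ)) (T : Set ℓ) (_<_ : Rel T ℓ)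
                  (tree : Order.IsTree _≡_ _<_) where
  open Order _≡_ _<_
  open IsTree tree
  open IsStrictPartialOrder isStrictPartialOrder using ()
    renaming (trans to <-trans; irrefl to <-irrefl)
  open IsStem
  open DC T _<_
  open DownSets (lowerExcludedMiddle em) _<_
  module D = Order _≈ᴰ_ _<ᴰ_

  dec : ExcludedMiddle ℓ
  dec = lowerExcludedMiddle em

  upperBound-step : ∀ {S : Pred T ℓ} {x y} → IsUpperBound S x → x < y → IsUpperBound S y
  upperBound-step ub x<y s Ss with ub s Ss
  ... | inj₁ s<x = inj₁ (<-trans s<x x<y)
  ... | inj₂ refl = inj₁ x<y

  noMaximum : (S : NewStem) → ∀ {u} → proj₁ S u → ¬ IsUpperBound (proj₁ S) u
  noMaximum (S , _ , noSup) {u} Su ub = noSup (u , ub , λ v ubv → ubv u Su)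

  upperBound-strict : (S : NewStem) → ∀ {x} → IsUpperBound (proj₁ S) x → ∀ s → proj₁ S s → s < x
  upperBound-strict S ub s Ss with ub s Ss
  ... | inj₁ s<x = s<x
  ... | inj₂ refl = ⊥-elim (noMaximum S Ss ub)

  ≈ᴰ-refl : ∀ {x} → x ≈ᴰ x
  ≈ᴰ-refl {inj₁ x} = refl
  ≈ᴰ-refl {inj₂ S} = id , id

  ≈ᴰ-sym : ∀ {x y} → x ≈ᴰ y → y ≈ᴰ x
  ≈ᴰ-sym {inj₁ _} {inj₁ _} e = sym e
  ≈ᴰ-sym {inj₂ _} {inj₂ _} (R⊆S , S⊆R) = S⊆R , R⊆S

  ≈ᴰ-trans : ∀ {x y z} → x ≈ᴰ y → y ≈ᴰ z → x ≈ᴰ z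
  ≈ᴰ-trans {inj₁ _} {inj₁ _} {inj₁ _} e f = trans e f
  ≈ᴰ-trans {inj₂ _} {inj₂ _} {inj₂ _} (R⊆S , S⊆R) (S⊆U , U⊆S) = S⊆U ∘ R⊆S , S⊆R ∘ U⊆S

  <ᴰ-irrefl : ∀ {x y} → x ≈ᴰ y → ¬ (x <ᴰ y)
  <ᴰ-irrefl {inj₁ _} {inj₁ _} e = <-irrefl e
  <ᴰ-irrefl {inj₂ _} {inj₂ _} (_ , S⊆R) (_ , S⊈R) = S⊈R S⊆R

  <ᴰ-trans : ∀ {x y z} → x <ᴰ y → y <ᴰ z → x <ᴰ z
  <ᴰ-trans {inj₁ _} {inj₁ _} {inj₁ _} p q = <-trans p q
  <ᴰ-trans {inj₁ _} {inj₁ _} {inj₂ (_ , st , _)} p q = downClosed st q p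
  <ᴰ-trans {inj₁ x} {inj₂ S} {inj₁ _} p q = upperBound-strict S q x p
  <ᴰ-trans {inj₁ _} {inj₂ _} {inj₂ _} p (R⊆S , _) = R⊆S p
  <ᴰ-trans {inj₂ _} {inj₁ _} {inj₁ _} p q = upperBound-step p q
  <ᴰ-trans {inj₂ R} {inj₁ u} {inj₂ (_ , st , _)} p q =
    (λ Rr → downClosed-≤ (downClosed st) q (p _ Rr)) , λ S⊆R → noMaximum R (S⊆R q) p
  <ᴰ-trans {inj₂ _} {inj₂ _} {inj₁ _} (R⊆S , _) q r Rr = q r (R⊆S Rr)
  <ᴰ-trans {inj₂ _} {inj₂ _} {inj₂ _} (R⊆S , S⊈R) (S⊆U , _) =
    S⊆U ∘ R⊆S , λ U⊆R → S⊈R (U⊆R ∘ S⊆U)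

  <ᴰ-respʳ-≈ᴰ : ∀ {x y y′} → y ≈ᴰ y′ → x <ᴰ y → x <ᴰ y′
  <ᴰ-respʳ-≈ᴰ {inj₁ _} {inj₁ _} {inj₁ _} refl p = p
  <ᴰ-respʳ-≈ᴰ {inj₂ _} {inj₁ _} {inj₁ _} refl p = p
  <ᴰ-respʳ-≈ᴰ {inj₁ _} {inj₂ _} {inj₂ _} (S⊆S′ , _) p = S⊆S′ p
  <ᴰ-respʳ-≈ᴰ {inj₂ _} {inj₂ _} {inj₂ _} (S⊆S′ , S′⊆S) (R⊆S , S⊈R) =
    S⊆S′ ∘ R⊆S , λ S′⊆R → S⊈R (S′⊆R ∘ S⊆S′)

  <ᴰ-respˡ-≈ᴰ : ∀ {x y y′} → y ≈ᴰ y′ → y <ᴰ x → y′ <ᴰ x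
  <ᴰ-respˡ-≈ᴰ {inj₁ _} {inj₁ _} {inj₁ _} refl p = p
  <ᴰ-respˡ-≈ᴰ {inj₂ _} {inj₁ _} {inj₁ _} refl p = p
  <ᴰ-respˡ-≈ᴰ {inj₁ _} {inj₂ _} {inj₂ _} (_ , S′⊆S) p s S′s = p s (S′⊆S S′s)
  <ᴰ-respˡ-≈ᴰ {inj₂ _} {inj₂ _} {inj₂ _} (S⊆S′ , S′⊆S) (S⊆U , U⊈S) =
    S⊆U ∘ S′⊆S , λ U⊆S′ → U⊈S (S′⊆S ∘ U⊆S′)

  isStrictPartialOrder-DC : IsStrictPartialOrder _≈ᴰ_ _<ᴰ_
  isStrictPartialOrder-DC = record
    { isEquivalence = record
      { refl = λ {x} → ≈ᴰ-refl {x}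
      ; sym = λ {x} {y} → ≈ᴰ-sym {x} {y}
      ; trans = λ {x} {y} {z} → ≈ᴰ-trans {x} {y} {z}
      }
    ; irrefl = λ {x} {y} → <ᴰ-irrefl {x} {y}
    ; trans = λ {x} {y} {z} → <ᴰ-trans {x} {y} {z}
    ; <-resp-≈ = (λ {x} {y} {y′} → <ᴰ-respʳ-≈ᴰ {x} {y} {y′})
               , (λ {x} {y} {y′} → <ᴰ-respˡ-≈ᴰ {x} {y} {y′})
    }

  ≤ᴰ-trans : ∀ {x y z} → x D.≤ y → y D.≤ z → x D.≤ z
  ≤ᴰ-trans {x} {y} {z} (inj₁ p) (inj₁ q) = inj₁ (<ᴰ-trans {x} {y} {z} p q)
  ≤ᴰ-trans {x} {y} {z} (inj₁ p) (inj₂ e) = inj₁ (<ᴰ-respʳ-≈ᴰ {x} {y} {z} e p)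
  ≤ᴰ-trans {x} {y} {z} (inj₂ e) (inj₁ q) = inj₁ (<ᴰ-respˡ-≈ᴰ {z} {y} {x} (≈ᴰ-sym {x} {y} e) q)
  ≤ᴰ-trans {x} {y} {z} (inj₂ e) (inj₂ f) = inj₂ (≈ᴰ-trans {x} {y} {z} e f)

  Comparableᴰ : Rel TDC ℓ
  Comparableᴰ x y = x <ᴰ y ⊎ x ≈ᴰ y ⊎ y <ᴰ x

  ≤ᴰ⇒comparable : ∀ {x y} → x D.≤ y → Comparableᴰ x y
  ≤ᴰ⇒comparable (inj₁ x<y) = inj₁ x<y
  ≤ᴰ⇒comparable (inj₂ x≈y) = inj₂ (inj₁ x≈y)

  comparableᴰ-sym : ∀ {x y} → Comparableᴰ x y → Comparableᴰ y x
  comparableᴰ-sym (inj₁ x<y) = inj₂ (inj₂ x<y)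
  comparableᴰ-sym {x} {y} (inj₂ (inj₁ x≈y)) = inj₂ (inj₁ (≈ᴰ-sym {x} {y} x≈y))
  comparableᴰ-sym (inj₂ (inj₂ y<x)) = inj₁ y<x

  ⊆⇒≤ᴰ : (R S : NewStem) → proj₁ R ⊆ proj₁ S → inj₂ R D.≤ inj₂ S
  ⊆⇒≤ᴰ R S R⊆S with dec {proj₁ S ⊆ proj₁ R}
  ... | yes S⊆R = inj₂ (R⊆S , S⊆R)
  ... | no S⊈R = inj₁ (R⊆S , S⊈R)

  stems-comparable : (R S : NewStem) → (∀ {r s} → proj₁ R r → proj₁ S s → Comparable r s)
                   → Comparableᴰ (inj₂ R) (inj₂ S)
  stems-comparable R@(_ , stR , _) S@(_ , stS , _) cmp
    with ⊆-total (downClosed stR) (downClosed stS) cmp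
  ... | inj₁ R⊆S = ≤ᴰ⇒comparable {inj₂ R} {inj₂ S} (⊆⇒≤ᴰ R S R⊆S)
  ... | inj₂ S⊆R =
    comparableᴰ-sym {inj₂ S} {inj₂ R} (≤ᴰ⇒comparable {inj₂ S} {inj₂ R} (⊆⇒≤ᴰ S R S⊆R))

  node-stem-comparable : (y : T) (R : NewStem) → (∀ r → proj₁ R r → Comparable r y)
                       → Comparableᴰ (inj₁ y) (inj₂ R)
  node-stem-comparable y (_ , st , _) cmp =
    [ inj₁ , inj₂ ∘ inj₂ ]′ (member⊎upperBound (downClosed st) cmp)

  nodesBelow-linear : ∀ z → Linear (λ t → inj₁ t <ᴰ z)
  nodesBelow-linear (inj₁ x) = predLinear x
  nodesBelow-linear (inj₂ (_ , st , _)) = linear st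

  predLinearᴰ : ∀ z → D.Linear (λ w → w <ᴰ z)
  predLinearᴰ z {inj₁ _} {inj₁ _} p q = nodesBelow-linear z p q
  predLinearᴰ z {inj₁ y} {inj₂ R} p q =
    node-stem-comparable y R λ r Rr → nodesBelow-linear z (<ᴰ-trans {inj₁ r} {inj₂ R} {z} Rr q) p
  predLinearᴰ z {inj₂ R} {inj₁ y} p q =
    comparableᴰ-sym {inj₁ y} {inj₂ R} (predLinearᴰ z {inj₁ y} {inj₂ R} q p)
  predLinearᴰ z {inj₂ R} {inj₂ S} p q =
    stems-comparable R S λ {r} {s} Rr Ss →
      nodesBelow-linear z (<ᴰ-trans {inj₁ r} {inj₂ R} {z} Rr p) (<ᴰ-trans {inj₁ s} {inj₂ S} {z} Ss q)

  nodeBelow : (x : TDC) → ∃ λ t → inj₁ t D.≤ x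
  nodeBelow (inj₁ t) = t , inj₂ refl
  nodeBelow (inj₂ (_ , st , _)) = proj₁ (nonEmpty st) , inj₁ (proj₂ (nonEmpty st))

  commonLowerBoundᴰ : ∀ x y → ∃ λ z → z D.≤ x × z D.≤ y
  commonLowerBoundᴰ x y with nodeBelow x | nodeBelow y
  ... | a , a≤x | b , b≤y with commonLowerBound a b
  ... | c , c≤a , c≤b =
    inj₁ c , ≤ᴰ-trans {inj₁ c} {inj₁ a} {x} c≤a a≤x , ≤ᴰ-trans {inj₁ c} {inj₁ b} {y} c≤b b≤y

  isTree : D.IsTree
  isTree = record
    { isStrictPartialOrder = isStrictPartialOrder-DC
    ; predLinear = predLinearᴰ
    ; commonLowerBound = commonLowerBoundᴰ
    }

  ≤ᴰ-comparable : ∀ {a b z} → a D.≤ z → b D.≤ z → Comparableᴰ a b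
  ≤ᴰ-comparable {a} {b} {z} (inj₁ a<z) (inj₁ b<z) = predLinearᴰ z a<z b<z
  ≤ᴰ-comparable {a} {b} {z} (inj₁ a<z) (inj₂ b≈z) =
    inj₁ (<ᴰ-respʳ-≈ᴰ {a} {z} {b} (≈ᴰ-sym {b} {z} b≈z) a<z)
  ≤ᴰ-comparable {a} {b} {z} (inj₂ a≈z) (inj₁ b<z) =
    inj₂ (inj₂ (<ᴰ-respʳ-≈ᴰ {b} {z} {a} (≈ᴰ-sym {a} {z} a≈z) b<z))
  ≤ᴰ-comparable {a} {b} {z} (inj₂ a≈z) (inj₂ b≈z) =
    inj₂ (inj₁ (≈ᴰ-trans {a} {z} {b} a≈z (≈ᴰ-sym {b} {z} b≈z)))

  module Infimum (X : Pred TDC (suc ℓ)) where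

    -- Lower bounds of X live in Set (suc ℓ); excluded middle resizes them to
    -- a predicate of level ℓ, as required for L to form a node of T^DC.
    L : Pred T ℓ
    L t = Lift ℓ (True (em {D.IsLowerBound X (inj₁ t)}))

    toL : ∀ {t} → D.IsLowerBound X (inj₁ t) → L t
    toL lb = lift (fromWitness lb)

    fromL : ∀ {t} → L t → D.IsLowerBound X (inj₁ t)
    fromL (lift w) = toWitness w

    L-downClosed : DownClosed L
    L-downClosed {a} {b} Lb a<b =
      toL λ x Xx → ≤ᴰ-trans {inj₁ a} {inj₁ b} {x} (inj₁ a<b) (fromL Lb x Xx)

    L⊆member : (R : NewStem) → X (inj₂ R) → L ⊆ proj₁ R
    L⊆member R XR Lt with fromL Lt _ XR
    ... | inj₁ Rt = Rt

    lowerStem⊆L : (S : NewStem) → D.IsLowerBound X (inj₂ S) → proj₁ S ⊆ L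
    lowerStem⊆L S lb {s} Ss = toL λ x Xx → ≤ᴰ-trans {inj₁ s} {inj₂ S} {x} (inj₁ Ss) (lb x Xx)

    L-isStem : ∃ X → ∃ (D.IsLowerBound X) → IsStem L
    L-isStem (x₀ , Xx₀) (l , lb) = record
      { nonEmpty = nonEmptyFrom l lb
      ; downClosed = L-downClosed
      ; linear = λ {a} {b} La Lb →
          ≤ᴰ-comparable {inj₁ a} {inj₁ b} {x₀} (fromL La x₀ Xx₀) (fromL Lb x₀ Xx₀)
      ; boundedAbove = boundedBy x₀ Xx₀
      }
      where
        nonEmptyFrom : ∀ l → D.IsLowerBound X l → ∃ L
        nonEmptyFrom (inj₁ t) lb = t , toL lb
        nonEmptyFrom (inj₂ S@(_ , st , _)) lb =
          proj₁ (nonEmpty st) , lowerStem⊆L S lb (proj₂ (nonEmpty st))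

        boundedBy : ∀ x → X x → ∃ (IsUpperBound L)
        boundedBy (inj₁ y) Xy = y , λ t Lt → fromL Lt _ Xy
        boundedBy (inj₂ R@(_ , st , _)) XR with boundedAbove st
        ... | u , ub = u , λ t Lt → ub t (L⊆member R XR Lt)

    supremum-isInfimum : ∀ {m} → IsSupremum L m → D.IsInfimum X (inj₁ m)
    supremum-isInfimum {m} (ub , least) = isLowerBound , greatest
      where
        isLowerBound : D.IsLowerBound X (inj₁ m)
        isLowerBound (inj₁ y) Xy = least y λ t Lt → fromL Lt _ Xy
        isLowerBound (inj₂ R@(S , st , noSup)) XR with ⊆⊎witness-∉ {S} {L}
        ... | inj₁ S⊆L = ⊥-elim (noSup (m , (λ s Ss → ub s (S⊆L Ss))
                                          , λ v ubv → least v λ t Lt → ubv t (L⊆member R XR Lt)))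
        ... | inj₂ (r , Sr , ¬Lr) = inj₁ (downClosed-≤ (downClosed st) Sr (least r bound))
          where
            bound : IsUpperBound L r
            bound = fromInj₂ (⊥-elim ∘ ¬Lr)
              (member⊎upperBound L-downClosed λ t Lt → linear st (L⊆member R XR Lt) Sr)

        greatest : ∀ l → D.IsLowerBound X l → l D.≤ inj₁ m
        greatest (inj₁ t) lb = ub t (toL lb)
        greatest (inj₂ S) lb = inj₁ λ s Ss → ub s (lowerStem⊆L S lb Ss)

    newNode-isInfimum : (stem : IsStem L) (noSup : ¬ HasSupremum L)
                      → D.IsInfimum X (inj₂ (L , stem , noSup))
    newNode-isInfimum stem noSup = isLowerBound , greatest
      where
        tL : NewStem
        tL = L , stem , noSup

        isLowerBound : D.IsLowerBound X (inj₂ tL)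
        isLowerBound (inj₁ y) Xy = inj₁ λ t Lt → fromL Lt _ Xy
        isLowerBound (inj₂ R) XR = ⊆⇒≤ᴰ tL R (L⊆member R XR)

        greatest : ∀ l → D.IsLowerBound X l → l D.≤ inj₂ tL
        greatest (inj₁ t) lb = inj₁ (toL lb)
        greatest (inj₂ S) lb = ⊆⇒≤ᴰ S tL (lowerStem⊆L S lb)

    infimum : ∃ X → ∃ (D.IsLowerBound X) → ∃ (D.IsInfimum X)
    infimum nonEmpty bounded with dec {HasSupremum L}
    ... | yes (m , sup) = inj₁ m , supremum-isInfimum sup
    ... | no noSup = _ , newNode-isInfimum (L-isStem nonEmpty bounded) noSup

  isComplete : D.IsComplete (suc ℓ)
  isComplete X = Infimum.infimum X

mainTheorem12 : {ℓ : Level} → ExcludedMiddle (suc ℓ) →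
    (T : Set ℓ) (_<_ : Rel T ℓ) → Order.IsTree _≡_ _<_ →
    Order.IsTree (DC._≈ᴰ_ T _<_) (DC._<ᴰ_ T _<_)
    × Order.IsComplete (DC._≈ᴰ_ T _<_) (DC._<ᴰ_ T _<_) (suc ℓ)
    × ((x y : T) → DC._≈ᴰ_ T _<_ (inj₁ x) (inj₁ y) → x ≡ y)
    × ((x y : T) → (x < y) ⇔ DC._<ᴰ_ T _<_ (inj₁ x) (inj₁ y))
mainTheorem12 em T _<_ tree =
  isTree , isComplete , (λ _ _ → id) , (λ _ _ → mk⇔ id id)
  where open Completion em T _<_ tree
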